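{- Let $\alpha\ge1$ and $i$ be integers with $0<i<\min(\alpha,i_{\max}+1)$, and let $y=b_1\cdots b_\alpha$ be an antemer of length $\alpha$ whose longest common prefix with $w$ has length exactly $i$ (so $b_1\cdots b_i=a_1\cdots a_i$ and $b_{i+1}\ne a_{i+1}$). Then $b_{i+1}\in\Sigma_A(i)$, where $$\Sigma_A(i)=\Sigma_{i+1}\cap\big(\Sigma_1\cup\{a_1\}\big)\cap\bigcap_{\substack{2\le j\le i\\ \mathbf{R}^=_{i,j}}}\big(\Sigma_{i-j+2}\cup\{a_{i-j+2}\}\big).$$
   Context: Let $\Sigma$ be a finite totally ordered alphabet with $|\Sigma|=2^b$; each letter is identified bijectively with a $b$-bit vector and $a\oplus a'$ is the letter whose bit vector is the componentwise XOR. For equal-length words, $\oplus$ acts letterwise; equal-length words are compared lexicographically. An $m$-mer of a word is a contiguous factor of length $m$. Fix integers $1\le m<k$, a word $w=a_1\cdots a_m\in\Sigma^m$ and a key $\gamma=c_1\cdots c_m\in\Sigma^m$. Autocorrelation matrix: for $1\le j\le i\le m$, $\mathbf{R}_{i,j}\in\{<,=,>\}$ is the relation with $\big((a_j\cdots a_i)\oplus(c_1\cdots c_{i-j+1})\big)\ \mathbf{R}_{i,j}\ \big((a_1\cdots a_{i-j+1})\oplus(c_1\cdots c_{i-j+1})\big)$; $\mathbf{R}^=_{i,j}$ means $\mathbf{R}_{i,j}$ is $=$. $i_{\max}=\min\big(\{m\}\cup\{2\le i\le m-1:\exists\, 2\le j\le i \text{ with } \mathbf{R}_{i,j} \text{ equal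 to } <\}\big)-1$. Specialized alphabets: for $1\le i\le m$, $\Sigma_i=\{a\in\Sigma: a\oplus c_i>a_i\oplus c_i\}$. A word $y$ is an antemer if every $m$-mer $w'$ of the word $yw$ other than the last one (the suffix $w$) satisfies $w'\oplus\gamma>w\oplus\gamma$. -}

module Defs where

open import Level using (0ℓ)
open import Data.Bool using (Bool; false; _xor_)
open import Data.Nat using (ℕ; zero; suc; _+_; _∸_; _≤_; _<_)
open import Data.Vec using (Vec; []; _∷_; zipWith; replicate; _++_)
open import Data.Product using (_×_; ∃)
open import Data.Sum using (_⊎_)
open import Data.Empty using (⊥)
open import Relation.Binary using (Rel)
open import Relation.Binary.PropositionalEquality using (_≡_)

-- A letter is identified with its b-bit vector; the total order on the
-- alphabet is an arbitrary strict total order on Vec Bool b (supplied as a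
-- parameter in the statement).  |Σ| = 2^b automatically.
Letter : ℕ → Set
Letter b = Vec Bool b

_⊕_ : ∀ {b} → Letter b → Letter b → Letter b
_⊕_ = zipWith _xor_

-- 1-based access w[i] = a_i; out-of-range returns a dummy letter (never
-- used in range-correct positions of the statement).
get : ∀ {b n} → Vec (Letter b) n → ℕ → Letter b
get {b} []       _             = replicate b false
get {b} (x ∷ xs) zero          = replicate b false
get     (x ∷ xs) (suc zero)    = x
get     (x ∷ xs) (suc (suc k)) = get xs (suc k)

LexLt : ∀ {b} → Rel (Letter b) 0ℓ → ℕ → (ℕ → Letter b) → (ℕ → Letter b) → Set
LexLt _<ₗ_ zero    f g = ⊥
LexLt _<ₗ_ (suc L) f g =
  (f 0 <ₗ g 0) ⊎ ((f 0 ≡ g 0) × LexLt _<ₗ_ L (λ k → f (suc k)) (λ k → g (suc k)))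

LexEq : ∀ {b} → ℕ → (ℕ → Letter b) → (ℕ → Letter b) → Set
LexEq L f g = ∀ k → k < L → f k ≡ g k

-- Autocorrelation matrix entries, for 1 ≤ j ≤ i ≤ m:
-- left word  (a_j ⋯ a_i) ⊕ (c_1 ⋯ c_{i-j+1}),
-- right word (a_1 ⋯ a_{i-j+1}) ⊕ (c_1 ⋯ c_{i-j+1}).
module _ {b m : ℕ} (_<ₗ_ : Rel (Letter b) 0ℓ) (w γ : Vec (Letter b) m) where

  Rleft : ℕ → ℕ → ℕ → Letter b
  Rleft i j k = get w (j + k) ⊕ get γ (suc k)

  Rright : ℕ → ℕ → ℕ → Letter b
  Rright i j k = get w (suc k) ⊕ get γ (suc k)

  R< : ℕ → ℕ → Set
  R< i j = LexLt _<ₗ_ (suc (i ∸ j)) (Rleft i j) (Rright i j)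

  R= : ℕ → ℕ → Set
  R= i j = LexEq (suc (i ∸ j)) (Rleft i j) (Rright i j)

  ImaxSet : ℕ → Set
  ImaxSet i = (i ≡ m) ⊎ ((2 ≤ i) × (i ≤ m ∸ 1) × ∃ λ j → (2 ≤ j) × (j ≤ i) × R< i j)

  InΣ : ℕ → Letter b → Set
  InΣ i x = (get w i ⊕ get γ i) <ₗ (x ⊕ get γ i)

  -- y is an antemer: every m-mer of y w starting at 0-based position p < α
  -- (i.e. every m-mer except the last one, the suffix w) satisfies
  -- w' ⊕ γ > w ⊕ γ.
  Antemer : ∀ {α} → Vec (Letter b) α → Set
  Antemer {α} y = ∀ p → p < α →
    LexLt _<ₗ_ m (λ k → get w (suc k) ⊕ get γ (suc k))
                 (λ k → get (y ++ w) (suc (p + k)) ⊕ get γ (suc k))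

  InΣA : ℕ → Letter b → Set
  InΣA i x = InΣ (suc i) x
           × (InΣ 1 x ⊎ x ≡ get w 1)
           × (∀ j → 2 ≤ j → j ≤ i → R= i j →
                InΣ (suc (i ∸ j) + 1) x ⊎ x ≡ get w (suc (i ∸ j) + 1))

IsMin : (ℕ → Set) → ℕ → Set
IsMin P μ = P μ × (∀ k → P k → μ ≤ k)

-- Each of the three memberships comes from one m-mer of y w that differs from
-- w in the letter b_{i+1}: the m-mer starting at b_1 (which agrees with w on
-- a_1 ⋯ a_i), the one starting at b_{i+1} itself, and, when R_{i,j} is "=", the
-- one starting at b_j, whose first letters b_j ⋯ b_i agree with a_1 ⋯ a_{i-j+1}
-- after XOR with the key.  Being greater than w ⊕ γ while agreeing with it on a
-- prefix of length n < m, such an m-mer has its next letter x ⊕ c_{n+1} at least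
-- a_{n+1} ⊕ c_{n+1}, that is x ∈ Σ_{n+1} ∪ {a_{n+1}}.
module Submission where

open import Defs
open import Level using (0ℓ)
open import Data.Bool using (false)
open import Data.Bool.Properties using (xor-assoc; xor-same; xor-identityʳ)
open import Data.Nat using (ℕ; zero; suc; _+_; _∸_; _≤_; _<_; _⊓_; z≤n; s≤s)
open import Data.Nat.Properties
open import Data.Vec using (Vec; _∷_; _++_; replicate)
open import Data.Vec.Properties using (zipWith-assoc; zipWith-inverseʳ; zipWith-identityʳ; map-id)
open import Data.Product using (_,_)
open import Data.Sum using (_⊎_; inj₁; inj₂)
open import Data.Empty using (⊥-elim)
open import Relation.Binary using (Rel; IsStrictTotalOrder; Irreflexive)
open import Relation.Binary.PropositionalEquality

⊕-self : ∀ {b} (c : Letter b) → c ⊕ c ≡ replicate b false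
⊕-self c = trans (cong (c ⊕_) (sym (map-id c))) (zipWith-inverseʳ xor-same c)

⊕-cancelʳ : ∀ {b} (a c : Letter b) → (a ⊕ c) ⊕ c ≡ a
⊕-cancelʳ a c = begin
  (a ⊕ c) ⊕ c          ≡⟨ zipWith-assoc xor-assoc a c c ⟩
  a ⊕ (c ⊕ c)          ≡⟨ cong (a ⊕_) (⊕-self c) ⟩
  a ⊕ replicate _ false ≡⟨ zipWith-identityʳ xor-identityʳ a ⟩
  a                    ∎
  where open ≡-Reasoning

⊕-injectiveˡ : ∀ {b} {a a′ : Letter b} (c : Letter b) → a ⊕ c ≡ a′ ⊕ c → a ≡ a′
⊕-injectiveˡ {a = a} {a′} c e =
  trans (sym (⊕-cancelʳ a c)) (trans (cong (_⊕ c) e) (⊕-cancelʳ a′ c))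

get-++ˡ : ∀ {b α m} (y : Vec (Letter b) α) (w : Vec (Letter b) m) {n} →
          1 ≤ n → n ≤ α → get (y ++ w) n ≡ get y n
get-++ˡ (x ∷ y) w {suc zero}    _ _         = refl
get-++ˡ (x ∷ y) w {suc (suc n)} _ (s≤s n<α) = get-++ˡ y w (s≤s z≤n) n<α

module _ {b : ℕ} {_<ₗ_ : Rel (Letter b) 0ℓ} (irrefl : Irreflexive _≡_ _<ₗ_) where

  LexLt⇒≤-after-common-prefix :
    ∀ L (f g : ℕ → Letter b) n → LexLt _<ₗ_ L f g →
    (∀ k → k < n → f k ≡ g k) → n < L → (f n <ₗ g n) ⊎ (f n ≡ g n)
  LexLt⇒≤-after-common-prefix (suc L) f g zero    (inj₁ f0<g0)      _      _ = inj₁ f0<g0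
  LexLt⇒≤-after-common-prefix (suc L) f g zero    (inj₂ (f0≡g0 , _)) _     _ = inj₂ f0≡g0
  LexLt⇒≤-after-common-prefix (suc L) f g (suc n) (inj₁ f0<g0)      prefix _ =
    ⊥-elim (irrefl (prefix 0 (s≤s z≤n)) f0<g0)
  LexLt⇒≤-after-common-prefix (suc L) f g (suc n) (inj₂ (_ , tail<)) prefix (s≤s n<L) =
    LexLt⇒≤-after-common-prefix L (λ k → f (suc k)) (λ k → g (suc k)) n tail<
      (λ k k<n → prefix (suc k) (s≤s k<n)) n<L

  module AntemerLetters {m α : ℕ} (w γ : Vec (Letter b) m) (y : Vec (Letter b) α)
           (antemer : Antemer _<ₗ_ w γ y) where

    antemer-letter-after-common-prefix :
      ∀ p n {q} → p + n ≡ q → p < α → n < m →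
      (∀ k → k < n → get (y ++ w) (suc (p + k)) ≡ get w (suc k)) →
      InΣ _<ₗ_ w γ (suc n) (get (y ++ w) (suc q)) ⊎ get (y ++ w) (suc q) ≡ get w (suc n)
    antemer-letter-after-common-prefix p n refl p<α n<m prefix
      with LexLt⇒≤-after-common-prefix m _ _ n (antemer p p<α)
             (λ k k<n → cong (_⊕ get γ (suc k)) (sym (prefix k k<n))) n<m
    ... | inj₁ above = inj₁ above
    ... | inj₂ equal = inj₂ (sym (⊕-injectiveˡ (get γ (suc n)) equal))

-- With j = j′ + 1, R_{i,j} = "=" says a_{j+k} ⊕ c_{k+1} ≡ a_{k+1} ⊕ c_{k+1}.
R=⇒shifted-prefix :
  ∀ {b m n} (_<ₗ_ : Rel (Letter b) 0ℓ) (w γ : Vec (Letter b) m) (u : Vec (Letter b) n) {i j′} →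
  suc j′ ≤ i → R= _<ₗ_ w γ i (suc j′) →
  (∀ t → 1 ≤ t → t ≤ i → get u t ≡ get w t) →
  ∀ k → k < suc (i ∸ suc j′) → get u (suc (j′ + k)) ≡ get w (suc k)
R=⇒shifted-prefix _<ₗ_ w γ u {i} {j′} j≤i autocorrelation-equal u≡w k k<i-j+1 =
  trans (u≡w (suc (j′ + k)) (s≤s z≤n) j+k≤i)
        (⊕-injectiveˡ (get γ (suc k)) (autocorrelation-equal k k<i-j+1))
  where
  j+k≤i : suc (j′ + k) ≤ i
  j+k≤i = begin
    suc (j′ + k)            ≤⟨ +-monoʳ-< j′ k<i-j+1 ⟩
    j′ + suc (i ∸ suc j′)   ≡⟨ +-suc j′ _ ⟩
    suc j′ + (i ∸ suc j′)   ≡⟨ m+[n∸m]≡n j≤i ⟩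
    i                       ∎
    where open ≤-Reasoning

lemma4 : (b : ℕ) (_<ₗ_ : Rel (Letter b) 0ℓ) → IsStrictTotalOrder _≡_ _<ₗ_ →
    (m k : ℕ) → 1 ≤ m → m < k →
    (w γ : Vec (Letter b) m) →
    (μ : ℕ) → IsMin (ImaxSet _<ₗ_ w γ) μ →
    (α i : ℕ) → 1 ≤ α → 0 < i → i < α ⊓ ((μ ∸ 1) + 1) →
    (y : Vec (Letter b) α) → Antemer _<ₗ_ w γ y →
    (∀ t → 1 ≤ t → t ≤ i → get y t ≡ get w t) →
    get y (suc i) ≢ get w (suc i) →
    InΣA _<ₗ_ w γ i (get y (suc i))
lemma4 b _<ₗ_ sto m _ 1≤m _ w γ μ (_ , μ-minimal) α i _ _ i<α⊓μ y antemer y≡w-upto-i y≢w =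
  Σ-i+1 , Σ-1 , Σ-i-j+2
  where
  open IsStrictTotalOrder sto using (irrefl)
  open AntemerLetters irrefl w γ y antemer renaming (antemer-letter-after-common-prefix to next)

  i<α : i < α
  i<α = m<n⊓o⇒m<n α _ i<α⊓μ

  i<m : i < m
  i<m = begin-strict
    i           <⟨ m<n⊓o⇒m<o α _ i<α⊓μ ⟩
    μ ∸ 1 + 1   ≤⟨ +-monoˡ-≤ 1 (∸-monoˡ-≤ 1 (μ-minimal m (inj₁ refl))) ⟩
    m ∸ 1 + 1   ≡⟨ m∸n+n≡m 1≤m ⟩
    m           ∎
    where open ≤-Reasoning

  yw≡w-upto-i : ∀ t → 1 ≤ t → t ≤ i → get (y ++ w) t ≡ get w t
  yw≡w-upto-i t 1≤t t≤i = trans (get-++ˡ y w 1≤t (≤-trans t≤i (<⇒≤ i<α))) (y≡w-upto-i t 1≤t t≤i)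

  yw[i+1] : get (y ++ w) (suc i) ≡ get y (suc i)
  yw[i+1] = get-++ˡ y w (s≤s z≤n) i<α

  Σ-i+1 : InΣ _<ₗ_ w γ (suc i) (get y (suc i))
  Σ-i+1 with next 0 i refl (≤-trans (s≤s z≤n) i<α) i<m (λ k → yw≡w-upto-i (suc k) (s≤s z≤n))
  ... | inj₁ above = subst (InΣ _<ₗ_ w γ (suc i)) yw[i+1] above
  ... | inj₂ equal = ⊥-elim (y≢w (trans (sym yw[i+1]) equal))

  Σ-1 : InΣ _<ₗ_ w γ 1 (get y (suc i)) ⊎ get y (suc i) ≡ get w 1
  Σ-1 = subst (λ x → InΣ _<ₗ_ w γ 1 x ⊎ x ≡ get w 1) yw[i+1]
          (next i 0 (+-identityʳ i) i<α 1≤m λ _ ())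

  Σ-i-j+2 : ∀ j → 2 ≤ j → j ≤ i → R= _<ₗ_ w γ i j →
            InΣ _<ₗ_ w γ (suc (i ∸ j) + 1) (get y (suc i))
              ⊎ get y (suc i) ≡ get w (suc (i ∸ j) + 1)
  Σ-i-j+2 (suc j′) _ j≤i autocorrelation-equal =
    subst₂ (λ q x → InΣ _<ₗ_ w γ q x ⊎ x ≡ get w q) (+-comm 1 (suc (i ∸ suc j′))) yw[i+1]
      (next j′ _ (trans (+-suc j′ _) (m+[n∸m]≡n j≤i)) (≤-trans j≤i (<⇒≤ i<α))
        (≤-<-trans i-j+1≤i i<m)
        (R=⇒shifted-prefix _<ₗ_ w γ (y ++ w) j≤i autocorrelation-equal yw≡w-upto-i))
    where
    i-j+1≤i : suc (i ∸ suc j′) ≤ i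
    i-j+1≤i = ≤-trans (≤-reflexive (sym (+-∸-assoc 1 j≤i))) (m∸n≤m i j′)
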